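{- (i) If $\tfrac{2}{j}\in\mathcal{F}_m$ for some $j$, then the fraction $$\begin{cases}\left(\left\lceil\tfrac{2m}{j}\right\rceil-1\right)\Big/\tfrac{j\left(\left\lceil\frac{2m}{j}\right\rceil-1\right)+1}{2}, & \text{if } \left\lceil\tfrac{2m}{j}\right\rceil\equiv 0\pmod 2,\\[2pt] \left(\left\lceil\tfrac{2m}{j}\right\rceil-2\right)\Big/\tfrac{j\left(\left\lceil\frac{2m}{j}\right\rceil-2\right)+1}{2}, & \text{if } \left\lceil\tfrac{2m}{j}\right\rceil\equiv 1\pmod 2,\end{cases}$$ precedes $\tfrac{2}{j}$ in $\mathcal{F}_m$; and the fraction $$\begin{cases}\left(\left\lceil\tfrac{2(m+1)}{j}\right\rceil-1\right)\Big/\tfrac{j\left(\left\lceil\frac{2(m+1)}{j}\right\rceil-1\right)-1}{2}, & \text{if } \left\lceil\tfrac{2(m+1)}{j}\right\rceil\equiv 0\pmod 2,\\[2pt] \left(\left\lceil\tfrac{2(m+1)}{j}\right\rceil-2\right)\Big/\tfrac{j\left(\left\lceil\frac{2(m+1)}{j}\right\rceil-2\right)-1}{2}, & \text{if } \left\lceil\tfrac{2(m+1)}{j}\right\rceil\equiv 1\pmod 2,\end{cases}$$ succeeds $\tfrac{2}{j}$ in $\mathcal{F}_m$. (ii) If $\tfrac{j-2}{j}\in\mathcal{F}_m$ for some $j$, then the fraction $$\begin{cases}\tfrac{(j-2)\left(\left\lceil\frac{2(m+1)}{j}\right\rceil-1\right)-1}{2}\Big/\tfrac{j\left(\left\lceil\frac{2(m+1)}{j}\right\rceil-1\right)-1}{2},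 & \text{if } \left\lceil\tfrac{2(m+1)}{j}\right\rceil\equiv 0\pmod 2,\\[2pt] \tfrac{(j-2)\left(\left\lceil\frac{2(m+1)}{j}\right\rceil-2\right)-1}{2}\Big/\tfrac{j\left(\left\lceil\frac{2(m+1)}{j}\right\rceil-2\right)-1}{2}, & \text{if } \left\lceil\tfrac{2(m+1)}{j}\right\rceil\equiv 1\pmod 2,\end{cases}$$ precedes $\tfrac{j-2}{j}$ in $\mathcal{F}_m$; and the fraction $$\begin{cases}\tfrac{(j-2)\left(\left\lceil\frac{2m}{j}\right\rceil-1\right)+1}{2}\Big/\tfrac{j\left(\left\lceil\frac{2m}{j}\right\rceil-1\right)+1}{2}, & \text{if } \left\lceil\tfrac{2m}{j}\right\rceil\equiv 0\pmod 2,\\[2pt] \tfrac{(j-2)\left(\left\lceil\frac{2m}{j}\right\rceil-2\right)+1}{2}\Big/\tfrac{j\left(\left\lceil\frac{2m}{j}\right\rceil-2\right)+1}{2}, & \text{if } \left\lceil\tfrac{2m}{j}\right\rceil\equiv 1\pmod 2,\end{cases}$$ succeeds $\tfrac{j-2}{j}$ in $\mathcal{F}_m$.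
   Context: For an integer $m>1$, the Farey sequence $\mathcal{F}_m$ of order $m$ is the ascending sequence of reduced fractions $\tfrac{h}{k}$ with $\tfrac{0}{1}\le\tfrac{h}{k}\le\tfrac{1}{1}$ and $1\le k\le m$. Here $x/y$ denotes the fraction with numerator $x$ and denominator $y$. -}

module Defs where

open import Data.Nat using (ℕ; zero; suc; _+_; _*_; _∸_; _≤_; _<_; _%_; _≡ᵇ_)
open import Data.Nat.DivMod using (_/_)
open import Data.Nat.Coprimality using (Coprime)
open import Data.Bool using (if_then_else_)
open import Data.Product using (_×_; _,_)
open import Relation.Nullary using (¬_)

Frac : Set
Frac = ℕ × ℕ

InFarey : ℕ → Frac → Set
InFarey m (h , k) = Coprime h k × h ≤ k × 1 ≤ k × k ≤ m

-- strict order of fractions with positive denominators (cross-multiplication)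
_<F_ : Frac → Frac → Set
(a , b) <F (c , d) = a * d < c * b

Precedes : ℕ → Frac → Frac → Set
Precedes m p q =
  InFarey m p × InFarey m q × p <F q ×
  (∀ r → InFarey m r → ¬ (p <F r × r <F q))

-- ceiling of a / j  (j ≥ 1); value at j = 0 is irrelevant
ceilDiv : ℕ → ℕ → ℕ
ceilDiv a zero = 0
ceilDiv a (suc k) = (a + k) / suc k

lead : ℕ → ℕ
lead c = if (c % 2) ≡ᵇ 0 then c ∸ 1 else c ∸ 2

tA : ℕ → ℕ → ℕ
tA m j = lead (ceilDiv (2 * m) j)

tB : ℕ → ℕ → ℕ
tB m j = lead (ceilDiv (2 * (m + 1)) j)

predTwo : ℕ → ℕ → Frac
predTwo m j = tA m j , (j * tA m j + 1) / 2

succTwo : ℕ → ℕ → Frac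
succTwo m j = tB m j , (j * tB m j ∸ 1) / 2

predJm2 : ℕ → ℕ → Frac
predJm2 m j = ((j ∸ 2) * tB m j ∸ 1) / 2 , (j * tB m j ∸ 1) / 2

succJm2 : ℕ → ℕ → Frac
succJm2 m j = ((j ∸ 2) * tA m j + 1) / 2 , (j * tA m j + 1) / 2

-- If 2/j or (j - 2)/j lies in F_m then j is odd, j ≥ 3. Two fractions a/b < c/d with
-- c b - a d = 1 and b, d ≤ m < b + d are adjacent in F_m, because every fraction strictly
-- between them has denominator at least b + d. For odd t, the fractions t/((j t ± 1)/2) are
-- unimodular neighbours of 2/j, and ((j - 2) t ± 1)/2 over (j t ± 1)/2 those of (j - 2)/j;
-- choosing t as the largest odd number below ⌈2m/j⌉, resp. ⌈2(m + 1)/j⌉, is exactly what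
-- puts the new denominator in the window (m - j, m].
module Submission where

open import Defs
open import Data.Nat
open import Data.Nat.Properties
open import Data.Nat.DivMod using (_/_; _%_; m≡m%n+[m/n]*n; m%n<n; m/n*n≤m; m*n/n≡m)
open import Data.Nat.Divisibility
open import Data.Nat.Coprimality using (Coprime)
open import Data.Nat.Tactic.RingSolver
open import Data.Bool using (true; false)
open import Data.Empty using (⊥-elim)
open import Function using (_∘_)
open import Data.List using (_∷_; [])
open import Data.Product using (_×_; _,_; proj₁; proj₂; ∃-syntax)
open import Relation.Binary.PropositionalEquality
open import Relation.Nullary using (¬_)

unimodular⇒coprimeˡ : ∀ a b c d → c * b ≡ a * d + 1 → Coprime a b
unimodular⇒coprimeˡ a b c d eq {i} (i∣a , i∣b) =
  ∣1⇒≡1 (∣m+n∣m⇒∣n (subst (i ∣_) eq (∣n⇒∣m*n c i∣b)) (∣m⇒∣m*n d i∣a))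

unimodular⇒coprimeʳ : ∀ a b c d → c * b ≡ a * d + 1 → Coprime c d
unimodular⇒coprimeʳ a b c d eq {i} (i∣c , i∣d) =
  ∣1⇒≡1 (∣m+n∣m⇒∣n (subst (i ∣_) eq (∣m⇒∣m*n b i∣c)) (∣n⇒∣m*n a i∣d))

unimodular⇒<F : ∀ a b c d → c * b ≡ a * d + 1 → (a , b) <F (c , d)
unimodular⇒<F a b c d eq = subst (a * d <_) (sym (trans eq (+-comm (a * d) 1))) ≤-refl

-- y = b (c y - d x) + d (b x - a y), and both brackets are at least 1.
unimodular-between⇒denominator : ∀ a b c d x y → c * b ≡ a * d + 1 →
  (a , b) <F (x , y) → (x , y) <F (c , d) → b + d ≤ y
unimodular-between⇒denominator a b c d x y eq ay<xb xd<cy =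
  +-cancelˡ-≤ (y * a * d) (b + d) y (begin
    y * a * d + (b + d)   ≡⟨ solve (a ∷ b ∷ d ∷ y ∷ []) ⟩
    d * suc (a * y) + b   ≤⟨ +-monoˡ-≤ b (*-monoʳ-≤ d ay<xb) ⟩
    d * (x * b) + b       ≡⟨ solve (b ∷ d ∷ x ∷ []) ⟩
    b * suc (x * d)       ≤⟨ *-monoʳ-≤ b xd<cy ⟩
    b * (c * y)           ≡⟨ solve (b ∷ c ∷ y ∷ []) ⟩
    y * (c * b)           ≡⟨ cong (y *_) eq ⟩
    y * (a * d + 1)       ≡⟨ solve (a ∷ d ∷ y ∷ []) ⟩
    y * a * d + y         ∎)
  where open ≤-Reasoning

unimodular⇒Precedes : ∀ {m a b c d} → c * b ≡ a * d + 1 →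
  a ≤ b → c ≤ d → 1 ≤ b → 1 ≤ d → b ≤ m → d ≤ m → m < b + d →
  Precedes m (a , b) (c , d)
unimodular⇒Precedes {m} {a} {b} {c} {d} eq a≤b c≤d 1≤b 1≤d b≤m d≤m m<b+d =
  (unimodular⇒coprimeˡ a b c d eq , a≤b , 1≤b , b≤m) ,
  (unimodular⇒coprimeʳ a b c d eq , c≤d , 1≤d , d≤m) ,
  unimodular⇒<F a b c d eq ,
  λ { (x , y) (_ , _ , _ , y≤m) (p<r , r<q) →
        <⇒≱ m<b+d (≤-trans (unimodular-between⇒denominator a b c d x y eq p<r r<q) y≤m) }

ceilDiv-bounds : ∀ a k → a ≤ ceilDiv a (suc k) * suc k × ceilDiv a (suc k) * suc k < a + suc k
ceilDiv-bounds a k = +-cancelʳ-≤ k a (c * suc k) lower , upper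
  where
  open ≤-Reasoning
  c : ℕ
  c = ceilDiv a (suc k)
  lower : a + k ≤ c * suc k + k
  lower = begin
    a + k                       ≡⟨ m≡m%n+[m/n]*n (a + k) (suc k) ⟩
    (a + k) % suc k + c * suc k ≤⟨ +-monoˡ-≤ (c * suc k) (≤-pred (m%n<n (a + k) (suc k))) ⟩
    k + c * suc k               ≡⟨ +-comm k _ ⟩
    c * suc k + k               ∎
  upper : c * suc k < a + suc k
  upper = begin-strict
    c * suc k ≤⟨ m/n*n≤m (a + k) (suc k) ⟩
    a + k     <⟨ +-monoʳ-< a (n<1+n k) ⟩
    a + suc k ∎

lead-4+ : ∀ k → lead (4 + k) ≡ 2 + lead (2 + k)
lead-4+ k with k % 2 ≡ᵇ 0
... | true  = refl
... | false = refl

lead-bounds : ∀ c → 2 ≤ c → ∃[ u ] lead c ≡ 1 + u * 2 × 2 + u * 2 ≤ c × c ≤ 3 + u * 2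
lead-bounds 1 (s≤s ())
lead-bounds 2 _ = 0 , refl , ≤-refl , s≤s (s≤s z≤n)
lead-bounds 3 _ = 0 , refl , s≤s (s≤s z≤n) , ≤-refl
lead-bounds (suc (suc (suc (suc k)))) _ with lead-bounds (2 + k) (s≤s (s≤s z≤n))
... | u , lead≡ , lower , upper = suc u , trans (lead-4+ k) (cong (2 +_) lead≡) , s≤s (s≤s lower) , s≤s (s≤s upper)

oddProductHalf : ℕ → ℕ → ℕ
oddProductHalf x y = x + y + x * y * 2

odd*odd : ∀ x y → (1 + x * 2) * (1 + y * 2) ≡ 1 + oddProductHalf x y * 2
odd*odd = expanded
  where
  expanded : ∀ x y → (1 + x * 2) * (1 + y * 2) ≡ 1 + (x + y + x * y * 2) * 2
  expanded = solve-∀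

odd<double⇒< : ∀ h n → 1 + h * 2 < n * 2 → h < n
odd<double⇒< h n lt = *-cancelʳ-< 2 h n (<-trans (n<1+n (h * 2)) lt)

double≤odd⇒≤ : ∀ n x → n * 2 ≤ 1 + x * 2 → n ≤ x
double≤odd⇒≤ n x le = ≤-pred (*-cancelʳ-< 2 n (suc x) (s≤s le))

lead-ceilDiv-sandwich : ∀ N k → 2 * suc k ≤ N →
  ∃[ u ] lead (ceilDiv N (suc k)) ≡ 1 + u * 2 ×
         (1 + u * 2) * suc k < N × N ≤ (3 + u * 2) * suc k
lead-ceilDiv-sandwich N k 2j≤N with ceilDiv N (suc k) | ceilDiv-bounds N k
... | c | N≤c*j , c*j<N+j with lead-bounds c (*-cancelʳ-≤ 2 c (suc k) (≤-trans 2j≤N N≤c*j))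
... | u , lead≡ , 2+2u≤c , c≤3+2u = u , lead≡ , t*j<N , ≤-trans N≤c*j (*-monoˡ-≤ (suc k) c≤3+2u)
  where
  open ≤-Reasoning
  t*j<N : (1 + u * 2) * suc k < N
  t*j<N = +-cancelˡ-< (suc k) _ N (begin-strict
    (2 + u * 2) * suc k ≤⟨ *-monoˡ-≤ (suc k) 2+2u≤c ⟩
    c * suc k           <⟨ c*j<N+j ⟩
    N + suc k           ≡⟨ +-comm N (suc k) ⟩
    suc k + N           ∎)

odd-sandwich-half : ∀ u v n → (1 + u * 2) * (1 + v * 2) < 2 * n → 2 * n ≤ (3 + u * 2) * (1 + v * 2) →
  oddProductHalf v u < n × n ≤ oddProductHalf v u + (1 + v * 2)
odd-sandwich-half u v n t*j<2n 2n≤[t+2]*j = h<n , n≤h+j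
  where
  open ≤-Reasoning
  j h : ℕ
  j = 1 + v * 2
  h = oddProductHalf v u
  t*j≡ : (1 + u * 2) * j ≡ 1 + h * 2
  t*j≡ = trans (*-comm (1 + u * 2) j) (odd*odd v u)
  regroup : ∀ h j → j + (j + (1 + h * 2)) ≡ 1 + (h + j) * 2
  regroup = solve-∀
  h<n : h < n
  h<n = odd<double⇒< h n (begin-strict
    1 + h * 2                   ≡⟨ t*j≡ ⟨
    (1 + u * 2) * j             <⟨ t*j<2n ⟩
    2 * n                       ≡⟨ *-comm 2 n ⟩
    n * 2                       ∎)
  n≤h+j : n ≤ h + j
  n≤h+j = double≤odd⇒≤ n (h + j) (begin
    n * 2                       ≡⟨ *-comm n 2 ⟩
    2 * n                       ≤⟨ 2n≤[t+2]*j ⟩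
    j + (j + (1 + u * 2) * j)   ≡⟨ cong (λ x → j + (j + x)) t*j≡ ⟩
    j + (j + (1 + h * 2))       ≡⟨ regroup h j ⟩
    1 + (h + j) * 2             ∎)

odd*odd∸1/2 : ∀ x y → ((1 + x * 2) * (1 + y * 2) ∸ 1) / 2 ≡ oddProductHalf x y
odd*odd∸1/2 x y = trans (cong (λ z → (z ∸ 1) / 2) (odd*odd x y)) (m*n/n≡m (oddProductHalf x y) 2)

odd*odd+1/2 : ∀ x y → ((1 + x * 2) * (1 + y * 2) + 1) / 2 ≡ 1 + oddProductHalf x y
odd*odd+1/2 x y = trans (cong (λ z → (z + 1) / 2) (odd*odd x y))
  (trans (cong (λ z → suc z / 2) (+-comm (oddProductHalf x y * 2) 1)) (m*n/n≡m (1 + oddProductHalf x y) 2))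

-- j = 3 + 2s is odd with j - 2 = i, t = 1 + 2u is odd, and j t = 2p + 1, i t = 2q + 1.
module OddNeighbours (s u : ℕ) where

  i j t p q : ℕ
  i = 1 + s * 2
  j = 1 + suc s * 2
  t = 1 + u * 2
  p = oddProductHalf (suc s) u
  q = oddProductHalf s u

  p≡q+t : p ≡ q + t
  p≡q+t = expanded s u
    where
    expanded : ∀ s u → suc s + u + suc s * u * 2 ≡ (s + u + s * u * 2) + (1 + u * 2)
    expanded = solve-∀

  t≤p : t ≤ p
  t≤p = subst (t ≤_) (sym p≡q+t) (m≤n+m t q)

  q≤p : q ≤ p
  q≤p = subst (q ≤_) (sym p≡q+t) (m≤m+n q t)

  1≤p : 1 ≤ p
  1≤p = ≤-trans (s≤s z≤n) t≤p

  2/j-predecessor : ∀ m → j ≤ m → p < m → m ≤ p + j → Precedes m (t , 1 + p) (2 , j)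
  2/j-predecessor m j≤m p<m m≤p+j =
    unimodular⇒Precedes (unimodular s u) (≤-trans t≤p (n≤1+n p)) (s≤s (s≤s z≤n))
      (s≤s z≤n) (s≤s z≤n) p<m j≤m (s≤s m≤p+j)
    where
    unimodular : ∀ s u → 2 * (1 + (suc s + u + suc s * u * 2)) ≡ (1 + u * 2) * (3 + s * 2) + 1
    unimodular = solve-∀

  2/j-successor : ∀ m → j ≤ m → p ≤ m → m < p + j → Precedes m (2 , j) (t , p)
  2/j-successor m j≤m p≤m m<p+j =
    unimodular⇒Precedes (unimodular s u) (s≤s (s≤s z≤n)) t≤p
      (s≤s z≤n) 1≤p j≤m p≤m (subst (m <_) (+-comm p j) m<p+j)
    where
    unimodular : ∀ s u → (1 + u * 2) * (3 + s * 2) ≡ 2 * (suc s + u + suc s * u * 2) + 1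
    unimodular = solve-∀

  i/j-predecessor : ∀ m → j ≤ m → p ≤ m → m < p + j → Precedes m (q , p) (i , j)
  i/j-predecessor m j≤m p≤m m<p+j =
    unimodular⇒Precedes (unimodular s u) q≤p (m≤n+m i 2) 1≤p (s≤s z≤n) p≤m j≤m m<p+j
    where
    unimodular : ∀ s u → (1 + s * 2) * (suc s + u + suc s * u * 2) ≡ (s + u + s * u * 2) * (3 + s * 2) + 1
    unimodular = solve-∀

  i/j-successor : ∀ m → j ≤ m → p < m → m ≤ p + j → Precedes m (i , j) (1 + q , 1 + p)
  i/j-successor m j≤m p<m m≤p+j =
    unimodular⇒Precedes (unimodular s u) (m≤n+m i 2) (s≤s q≤p) (s≤s z≤n) (s≤s z≤n) j≤m p<m
      (subst (m <_) (+-comm (1 + p) j) (s≤s m≤p+j))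
    where
    unimodular : ∀ s u → (1 + (s + u + s * u * 2)) * (3 + s * 2) ≡ (1 + s * 2) * (1 + (suc s + u + suc s * u * 2)) + 1
    unimodular = solve-∀

  predTwo≡ : ∀ m → tA m j ≡ t → predTwo m j ≡ (t , 1 + p)
  predTwo≡ m tA≡t = cong₂ _,_ tA≡t (trans (cong (λ x → (j * x + 1) / 2) tA≡t) (odd*odd+1/2 (suc s) u))

  succJm2≡ : ∀ m → tA m j ≡ t → succJm2 m j ≡ (1 + q , 1 + p)
  succJm2≡ m tA≡t = cong₂ _,_ (trans (cong (λ x → (i * x + 1) / 2) tA≡t) (odd*odd+1/2 s u))
                              (trans (cong (λ x → (j * x + 1) / 2) tA≡t) (odd*odd+1/2 (suc s) u))

  succTwo≡ : ∀ m → tB m j ≡ t → succTwo m j ≡ (t , p)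
  succTwo≡ m tB≡t = cong₂ _,_ tB≡t (trans (cong (λ x → (j * x ∸ 1) / 2) tB≡t) (odd*odd∸1/2 (suc s) u))

  predJm2≡ : ∀ m → tB m j ≡ t → predJm2 m j ≡ (q , p)
  predJm2≡ m tB≡t = cong₂ _,_ (trans (cong (λ x → (i * x ∸ 1) / 2) tB≡t) (odd*odd∸1/2 s u))
                              (trans (cong (λ x → (j * x ∸ 1) / 2) tB≡t) (odd*odd∸1/2 (suc s) u))

neighbours-via-tA : ∀ m s → 3 + s * 2 ≤ m →
  Precedes m (predTwo m (3 + s * 2)) (2 , 3 + s * 2) × Precedes m (1 + s * 2 , 3 + s * 2) (succJm2 m (3 + s * 2))
neighbours-via-tA m s j≤m with lead-ceilDiv-sandwich (2 * m) (suc s * 2) (*-monoʳ-≤ 2 j≤m)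
... | u , tA≡t , t*j<2m , 2m≤[t+2]*j with odd-sandwich-half u (suc s) m t*j<2m 2m≤[t+2]*j
... | p<m , m≤p+j =
  subst (λ f → Precedes m f (2 , j)) (sym (predTwo≡ m tA≡t)) (2/j-predecessor m j≤m p<m m≤p+j) ,
  subst (Precedes m (i , j)) (sym (succJm2≡ m tA≡t)) (i/j-successor m j≤m p<m m≤p+j)
  where open OddNeighbours s u

neighbours-via-tB : ∀ m s → 3 + s * 2 ≤ m →
  Precedes m (2 , 3 + s * 2) (succTwo m (3 + s * 2)) × Precedes m (predJm2 m (3 + s * 2)) (1 + s * 2 , 3 + s * 2)
neighbours-via-tB m s j≤m
  with lead-ceilDiv-sandwich (2 * suc m) (suc s * 2) (*-monoʳ-≤ 2 (m≤n⇒m≤1+n j≤m))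
... | u , tB≡t , t*j<2m , 2m≤[t+2]*j with odd-sandwich-half u (suc s) (suc m) t*j<2m 2m≤[t+2]*j
... | p<1+m , 1+m≤p+j =
  subst (Precedes m (2 , j)) (sym (succTwo≡ m tB≡t')) (2/j-successor m j≤m (≤-pred p<1+m) 1+m≤p+j) ,
  subst (λ f → Precedes m f (i , j)) (sym (predJm2≡ m tB≡t')) (i/j-predecessor m j≤m (≤-pred p<1+m) 1+m≤p+j)
  where
  open OddNeighbours s u
  tB≡t' : tB m j ≡ t
  tB≡t' = trans (cong (λ n → lead (ceilDiv (2 * n) j)) (+-comm m 1)) tB≡t

odd≥3 : ∀ j → 2 ≤ j → ¬ 2 ∣ j → ∃[ s ] j ≡ 3 + s * 2
odd≥3 1 (s≤s ()) _
odd≥3 2 _ 2∤j = ⊥-elim (2∤j ∣-refl)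
odd≥3 3 _ _ = 0 , refl
odd≥3 (suc (suc (suc (suc k)))) _ 2∤j with odd≥3 (2 + k) (s≤s (s≤s z≤n)) (2∤j ∘ ∣m∣n⇒∣m+n ∣-refl)
... | s , refl = suc s , refl

coprime-even⇒odd : ∀ {a b} → Coprime a b → 2 ∣ a → ¬ 2 ∣ b
coprime-even⇒odd co 2∣a 2∣b with co (2∣a , 2∣b)
... | ()

2∣j⇒2∣j∸2 : ∀ {j} → 2 ≤ j → 2 ∣ j → 2 ∣ j ∸ 2
2∣j⇒2∣j∸2 {suc zero} (s≤s ()) _
2∣j⇒2∣j∸2 {suc (suc k)} _ 2∣j = ∣m+n∣m⇒∣n 2∣j ∣-refl

corollary3p3 : ∀ (m j : ℕ) → 1 < m →
    (InFarey m (2 , j) →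
      Precedes m (predTwo m j) (2 , j) × Precedes m (2 , j) (succTwo m j)) ×
    (2 ≤ j → InFarey m (j ∸ 2 , j) →
      Precedes m (predJm2 m j) (j ∸ 2 , j) × Precedes m (j ∸ 2 , j) (succJm2 m j))
corollary3p3 m j _ = part-i , part-ii
  where
  part-i : InFarey m (2 , j) → Precedes m (predTwo m j) (2 , j) × Precedes m (2 , j) (succTwo m j)
  part-i (coprime , 2≤j , _ , j≤m) with odd≥3 j 2≤j (coprime-even⇒odd coprime ∣-refl)
  ... | s , refl = proj₁ (neighbours-via-tA m s j≤m) , proj₁ (neighbours-via-tB m s j≤m)

  part-ii : 2 ≤ j → InFarey m (j ∸ 2 , j) →
    Precedes m (predJm2 m j) (j ∸ 2 , j) × Precedes m (j ∸ 2 , j) (succJm2 m j)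
  part-ii 2≤j (coprime , _ , _ , j≤m) with odd≥3 j 2≤j (λ 2∣j → coprime-even⇒odd coprime (2∣j⇒2∣j∸2 2≤j 2∣j) 2∣j)
  ... | s , refl = proj₂ (neighbours-via-tB m s j≤m) , proj₂ (neighbours-via-tA m s j≤m)
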